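{- Let $n\geq 4$, $k\geq 5$, and let $f_1^{n,k},\dots,f_n^{n,k}$ be a valid dynamic task allocation with maximum switching cost at most $2$. Let $\vec v$ be a demand vector with at least four non-zero entries. Then there exists a task $t$ that is of type 2 with respect to $\vec v$ such that $\vec v$ has at least four non-empty tasks distinct from $t$. Moreover, for any such task $t$, if $i$ is the intermediate task of $t$ with respect to $\vec v$ and $\vec v'$ is the demand vector such that $(\vec v,\vec v')$ is $(i,t)$-adjacent, then $t$ is of type 2 with intermediate task $i$ with respect to $\vec v'$.
   Context: A demand vector for $n$ agents and $k$ tasks is $\vec v=(v_1,\dots,v_k)$ of non-negative integers summing to $n$; task $j$ is non-empty if $v_j\geq 1$. A valid dynamic task allocation is a family of functions $f_1^{n,k},\dots,f_n^{n,k}$ from demand vectors to $[k]$ such that for every $\vec v$ and task $j$, exactly $v_j$ agents $a$ have $f_a^{n,k}(\vec v)=j$. The switching cost of $(\vec v,\vec v')$ is the number of agents $a$ with $f_a^{n,k}(\vec v)\neq f_a^{n,k}(\vec v')$; the maximum switching cost is its maximum over pairs at $\ell_1$ distance $2$. $(\vec v_1,\vec v_2)$ is $(s,t)$-adjacent if $\vec v_2$ is obtained from $\vec v_1$ by moving one unit of demand from task $s$ to task $t\neq s$. Agent $a$ is $(i,j)$-mobile for $(\vec v_1,\vec v_2)$ if $f_a^{n,k}(\vec v_1)=i\neq j=f_a^{n,k}(\vec v_2)$. If $(\vec v_1,\vec v_2)$ is $(s,t)$-adjacent with switching cost $2$, its intermediate task is the task $i$ such that one agent is $(s,i)$-mobile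 and another is $(i,t)$-mobile. A task $t$ is of type 1 with respect to $\vec v$ if moving a unit of demand in $\vec v$ from any task to $t$ yields switching cost $1$. A task $t$ is of type 2 with respect to $\vec v$ if there exist a task $i$ and an agent $a$ such that moving a unit of demand in $\vec v$ from any task other than $i$ to $t$ yields switching cost $2$, intermediate task $i$, and $(i,t)$-mobile agent $a$; $i$ is the intermediate task of $t$ with respect to $\vec v$. -}

module Defs where

open import Data.Nat using (ℕ; zero; suc; _+_; _≤_; _≤?_; ∣_-_∣)
open import Data.Fin using (Fin; zero; suc; _≟_)
open import Data.Vec using (Vec; lookup)
open import Data.Bool using (Bool; true; false; if_then_else_; _∧_; not)
open import Data.Product using (Σ; ∃; ∃-syntax; _×_; _,_)
open import Relation.Nullary using (¬_; does)
open import Relation.Binary.PropositionalEquality using (_≡_; _≢_)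

count : ∀ {m} → (Fin m → Bool) → ℕ
count {zero}  p = 0
count {suc m} p = (if p zero then 1 else 0) + count (λ x → p (suc x))

sumFin : ∀ {m} → (Fin m → ℕ) → ℕ
sumFin {zero}  g = 0
sumFin {suc m} g = g zero + sumFin (λ x → g (suc x))

record Demand (n k : ℕ) : Set where
  constructor demand
  field
    vec   : Vec ℕ k
    total : sumFin (lookup vec) ≡ n
open Demand public

_at_ : ∀ {n k} → Demand n k → Fin k → ℕ
v at j = lookup (vec v) j

Allocation : ℕ → ℕ → Set
Allocation n k = Fin n → Demand n k → Fin k

Valid : ∀ {n k} → Allocation n k → Set
Valid {n} {k} f = ∀ (v : Demand n k) (j : Fin k) →
  count (λ a → does (f a v ≟ j)) ≡ v at j

switchingCost : ∀ {n k} → Allocation n k → Demand n k → Demand n k → ℕ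
switchingCost f v w = count (λ a → not (does (f a v ≟ f a w)))

ℓ1 : ∀ {n k} → Demand n k → Demand n k → ℕ
ℓ1 v w = sumFin (λ j → ∣ v at j - w at j ∣)

MaxCostAtMost : ∀ {n k} → Allocation n k → ℕ → Set
MaxCostAtMost {n} {k} f c = ∀ (v w : Demand n k) → ℓ1 v w ≡ 2 → switchingCost f v w ≤ c

Adjacent : ∀ {n k} → Fin k → Fin k → Demand n k → Demand n k → Set
Adjacent s t v₁ v₂ =
  s ≢ t × suc (v₂ at s) ≡ v₁ at s × v₂ at t ≡ suc (v₁ at t) ×
  (∀ j → j ≢ s → j ≢ t → v₂ at j ≡ v₁ at j)

Mobile : ∀ {n k} → Allocation n k → Fin n → Fin k → Fin k → Demand n k → Demand n k → Set
Mobile f a i j v₁ v₂ = f a v₁ ≡ i × f a v₂ ≡ j × i ≢ j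

Intermediate : ∀ {n k} → Allocation n k → Fin k → Fin k → Demand n k → Demand n k → Fin k → Set
Intermediate f s t v₁ v₂ i =
  ∃[ b ] ∃[ c ] (b ≢ c × Mobile f b s i v₁ v₂ × Mobile f c i t v₁ v₂)

Type2With : ∀ {n k} → Allocation n k → Demand n k → Fin k → Fin k → Fin n → Set
Type2With f v t i a = ∀ s w → s ≢ i → Adjacent s t v w →
  switchingCost f v w ≡ 2 × Intermediate f s t v w i × Mobile f a i t v w

Type2 : ∀ {n k} → Allocation n k → Demand n k → Fin k → Set
Type2 f v t = ∃[ i ] ∃[ a ] Type2With f v t i a

nonEmpty : ∀ {n k} → Demand n k → ℕ
nonEmpty v = count (λ j → does (1 ≤? v at j))

nonEmptyExcept : ∀ {n k} → Demand n k → Fin k → ℕ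
nonEmptyExcept v t = count (λ j → does (1 ≤? v at j) ∧ not (does (j ≟ t)))

module Submission where

-- When one unit of demand moves from s to t, at most two agents switch, so the agents either
-- make a direct step (one agent goes from s to t) or a relay (s → i → t); t is of type 2 with
-- intermediate i when every move into t from s ≠ i is a relay through i with the same last agent.
-- A single relay into t already makes t of type 2, by comparing the two targets of moves from
-- different sources, which are adjacent demands.
-- For the first claim take t with non-empty tasks p, q, r, r′ besides it. If the moves from q, r, r′
-- to t are all direct, look, for each pair x, y of them, at the demand where x's unit went to t and
-- y's unit to p. The two moved agents either end up one at t and one at p, or both at t while an
-- agent of t passes on to p. The first option cannot hold for all three pairs, since the three
-- demands are pairwise adjacent and some agent would be sent to p in one and to t in another; the
-- second option makes the move from x to p a relay through t, so p is of type 2.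
-- The second claim is the same argument at v′ with t in the role of p and i in the role of t,
-- once one checks that moving a unit from i to t in v only moves the mobile agent.

import Algebra.Properties.CommutativeSemigroup as CommSemigroupProperties
open import Data.Bool using (Bool; true; false; if_then_else_; _∧_; not; T)
open import Data.Bool.Properties using (∧-identityʳ; ∧-zeroʳ)
open import Data.Empty using (⊥; ⊥-elim)
open import Data.Fin using (Fin; zero; suc; _≟_)
open import Data.Fin.Properties using (any?)
open import Data.Nat using (ℕ; zero; suc; _+_; _∸_; _≤_; _<_; _≤?_; z≤n; s≤s; ∣_-_∣)
open import Data.Nat.Properties
  using ( ≤-refl; ≤-trans; ≤-reflexive; ≤-pred; m≤m+n; n≤1+n; 1+n≢n; 1+n≰n; n≢0⇒n>0; ≤ᵇ⇒≤; +-monoˡ-≤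
        ; +-comm; +-assoc; +-identityʳ; +-cancelˡ-≡; +-cancelʳ-≡; m∸n+n≡m; ∣m+n-m+o∣≡∣n-o∣
        ; ≡-irrelevant; +-commutativeSemigroup )
  renaming (_≟_ to _≟ℕ_)
open import Data.Nat.Tactic.RingSolver using (solve-∀)
open import Data.Product using (Σ; Σ-syntax; ∃; ∃-syntax; _×_; _,_; proj₁; proj₂; map)
open import Data.Sum using (_⊎_; inj₁; inj₂; map₂)
open import Data.Unit using (tt)
open import Data.Vec using (lookup; tabulate)
open import Data.Vec.Properties using (lookup∘tabulate; tabulate∘lookup; tabulate-cong)
open import Function using (_∘_; id)
open import Relation.Nullary using (¬_; yes; no; does)
open import Relation.Nullary.Decidable using (dec-true; dec-false)
open import Relation.Binary.PropositionalEquality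

open import Defs

open CommSemigroupProperties +-commutativeSemigroup using (x∙yz≈y∙xz; xy∙z≈zy∙x; xy∙z≈xz∙y; interchange)

≢-by : ∀ {A : Set} {p q x y : A} → p ≡ x → q ≡ y → x ≢ y → p ≢ q
≢-by refl refl x≢y = x≢y

preimages-≢ : ∀ {A B : Set} (h : A → B) {a b x y} → h a ≡ x → h b ≡ y → x ≢ y → a ≢ b
preimages-≢ h ha hb x≢y refl = x≢y (trans (sym ha) hb)

χ : Bool → ℕ
χ b = if b then 1 else 0

χ≤1 : ∀ b → χ b ≤ 1
χ≤1 true  = ≤-refl
χ≤1 false = z≤n

infixl 6 _without_

_without_ : ∀ {m} → (Fin m → Bool) → Fin m → Fin m → Bool
(P without b) a = P a ∧ not (does (a ≟ b))

count-cong : ∀ {m} {P Q : Fin m → Bool} → (∀ a → P a ≡ Q a) → count P ≡ count Q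
count-cong {zero}  P≗Q = refl
count-cong {suc m} P≗Q = cong₂ _+_ (cong χ (P≗Q zero)) (count-cong (P≗Q ∘ suc))

count-false : ∀ {m} → count {m} (λ _ → false) ≡ 0
count-false {zero}  = refl
count-false {suc m} = count-false {m}

count-true : ∀ {m} → count {m} (λ _ → true) ≡ m
count-true {zero}  = refl
count-true {suc m} = cong suc (count-true {m})

count-split : ∀ {m} (P : Fin m → Bool) b → count P ≡ χ (P b) + count (P without b)
count-split {suc m} P zero    = cong (χ (P zero) +_)
  (cong₂ _+_ (cong χ (sym (∧-zeroʳ (P zero)))) (count-cong {m} λ a → sym (∧-identityʳ (P (suc a)))))
count-split {suc m} P (suc b) = begin
    χ (P zero) + count (P ∘ suc)
  ≡⟨ cong (χ (P zero) +_) (count-split (P ∘ suc) b) ⟩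
    χ (P zero) + (χ (P (suc b)) + count (P ∘ suc without b))
  ≡⟨ x∙yz≈y∙xz (χ (P zero)) (χ (P (suc b))) (count (P ∘ suc without b)) ⟩
    χ (P (suc b)) + (χ (P zero) + count (P ∘ suc without b))
  ≡⟨ cong (λ x → χ (P (suc b)) + (χ x + count (P ∘ suc without b))) (sym (∧-identityʳ (P zero))) ⟩
    χ (P (suc b)) + count (P without suc b)
  ∎
  where open ≡-Reasoning

without-other : ∀ {m} (P : Fin m → Bool) {a b} → a ≢ b → (P without b) a ≡ P a
without-other P {a} {b} a≢b rewrite dec-false (a ≟ b) a≢b = ∧-identityʳ (P a)

without-elim : ∀ {m} (P : Fin m → Bool) {a b} → (P without b) a ≡ true → P a ≡ true × a ≢ b
without-elim P {a} {b} eq with P a | a ≟ b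
... | true | no a≢b = refl , a≢b

count-without : ∀ {m} (P : Fin m → Bool) {b} → P b ≡ true → count P ≡ suc (count (P without b))
count-without P {b} Pb = trans (count-split P b) (cong (λ x → χ x + count (P without b)) Pb)

witness⇒1≤count : ∀ {m} (P : Fin m → Bool) {b} → P b ≡ true → 1 ≤ count P
witness⇒1≤count P Pb = ≤-trans (s≤s z≤n) (≤-reflexive (sym (count-without P Pb)))

count≤1+without : ∀ {m} (P : Fin m → Bool) b → count P ≤ suc (count (P without b))
count≤1+without P b = ≤-trans (≤-reflexive (count-split P b)) (+-monoˡ-≤ (count (P without b)) (χ≤1 (P b)))

without-true : ∀ {m} (P : Fin m → Bool) {a b} → P a ≡ true → a ≢ b → (P without b) a ≡ true
without-true P Pa a≢b = trans (without-other P a≢b) Pa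

count-split₂ : ∀ {m} (P : Fin m → Bool) {b d} → d ≢ b →
  count P ≡ (χ (P b) + χ (P d)) + count (P without b without d)
count-split₂ P {b} {d} d≢b = begin
    count P
  ≡⟨ count-split P b ⟩
    χ (P b) + count (P without b)
  ≡⟨ cong (χ (P b) +_) (count-split (P without b) d) ⟩
    χ (P b) + (χ ((P without b) d) + count (P without b without d))
  ≡⟨ cong (λ x → χ (P b) + (χ x + count (P without b without d))) (without-other P d≢b) ⟩
    χ (P b) + (χ (P d) + count (P without b without d))
  ≡⟨ sym (+-assoc (χ (P b)) (χ (P d)) (count (P without b without d))) ⟩
    (χ (P b) + χ (P d)) + count (P without b without d)
  ∎
  where open ≡-Reasoning

without₂-cong : ∀ {m} {P Q : Fin m → Bool} {b d} → (∀ a → a ≢ b → a ≢ d → P a ≡ Q a) →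
  ∀ a → (P without b without d) a ≡ (Q without b without d) a
without₂-cong {P = P} {Q} {b} {d} P≗Q a with a ≟ b | a ≟ d
... | yes refl | _        = cong (_∧ _) (trans (∧-zeroʳ (P a)) (sym (∧-zeroʳ (Q a))))
... | no _     | yes refl = trans (∧-zeroʳ _) (sym (∧-zeroʳ _))
... | no a≢b   | no a≢d   = begin
    (P a ∧ true) ∧ true ≡⟨ ∧-identityʳ _ ⟩
    P a ∧ true          ≡⟨ ∧-identityʳ _ ⟩
    P a                 ≡⟨ P≗Q a a≢b a≢d ⟩
    Q a                 ≡⟨ sym (∧-identityʳ _) ⟩
    Q a ∧ true          ≡⟨ sym (∧-identityʳ _) ⟩
    (Q a ∧ true) ∧ true ∎
  where open ≡-Reasoning

count-agree-except₂ : ∀ {m} (P Q : Fin m → Bool) {b d} → d ≢ b → (∀ a → a ≢ b → a ≢ d → P a ≡ Q a) →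
  count P + (χ (Q b) + χ (Q d)) ≡ count Q + (χ (P b) + χ (P d))
count-agree-except₂ P Q {b} {d} d≢b P≗Q = begin
    count P + (χ (Q b) + χ (Q d))
  ≡⟨ cong (_+ _) (count-split₂ P d≢b) ⟩
    (χ (P b) + χ (P d)) + count (P without b without d) + (χ (Q b) + χ (Q d))
  ≡⟨ cong (λ r → (χ (P b) + χ (P d)) + r + (χ (Q b) + χ (Q d))) (count-cong (without₂-cong P≗Q)) ⟩
    (χ (P b) + χ (P d)) + count (Q without b without d) + (χ (Q b) + χ (Q d))
  ≡⟨ xy∙z≈zy∙x (χ (P b) + χ (P d)) (count (Q without b without d)) (χ (Q b) + χ (Q d)) ⟩
    (χ (Q b) + χ (Q d)) + count (Q without b without d) + (χ (P b) + χ (P d))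
  ≡⟨ cong (_+ _) (sym (count-split₂ Q d≢b)) ⟩
    count Q + (χ (P b) + χ (P d))
  ∎
  where open ≡-Reasoning

count≡2 : ∀ {m} (P : Fin m → Bool) {b d} → d ≢ b → P b ≡ true → P d ≡ true →
  (∀ a → a ≢ b → a ≢ d → P a ≡ false) → count P ≡ 2
count≡2 {m} P {b} {d} d≢b Pb Pd others = begin
    count P                                              ≡⟨ count-split₂ P d≢b ⟩
    (χ (P b) + χ (P d)) + count (P without b without d) ≡⟨ cong₂ (λ x y → χ x + χ y + count (P without b without d)) Pb Pd ⟩
    2 + count (P without b without d)                   ≡⟨ cong (2 +_) (count-cong (without₂-cong {Q = λ (_ : Fin m) → false} others)) ⟩
    2 + count {m} (λ _ → false)                         ≡⟨ cong (2 +_) (count-false {m}) ⟩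
    2                                                    ∎
  where open ≡-Reasoning

count-witness : ∀ {m} (P : Fin m → Bool) → 1 ≤ count P → ∃[ a ] P a ≡ true
count-witness {suc m} P 1≤count with P zero in P0
... | true  = zero , P0
... | false with count-witness (P ∘ suc) 1≤count
...   | a , Pa = suc a , Pa

count-pick : ∀ {m} (P : Fin m → Bool) {r} → suc r ≤ count P → ∃[ a ] P a ≡ true × r ≤ count (P without a)
count-pick P r<count with count-witness P (≤-trans (s≤s z≤n) r<count)
... | a , Pa = a , Pa , ≤-pred (≤-trans r<count (≤-reflexive (count-without P Pa)))

count<⇒difference : ∀ {m} (P Q : Fin m → Bool) → count Q < count P → ∃[ a ] P a ≡ true × Q a ≡ false
count<⇒difference {suc m} P Q lt with P zero in P0 | Q zero in Q0
... | true  | false = zero , P0 , Q0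
... | true  | true  = map suc id (count<⇒difference (P ∘ suc) (Q ∘ suc) (≤-pred lt))
... | false | false = map suc id (count<⇒difference (P ∘ suc) (Q ∘ suc) lt)
... | false | true  = map suc id (count<⇒difference (P ∘ suc) (Q ∘ suc) (≤-trans (n≤1+n _) lt))

record Distinct₃ {m} (P : Fin m → Bool) : Set where
  field
    x y z    : Fin m
    Px       : P x ≡ true
    Py       : P y ≡ true
    Pz       : P z ≡ true
    x≢y      : x ≢ y
    x≢z      : x ≢ z
    y≢z      : y ≢ z

distinct₃ : ∀ {m} (P : Fin m → Bool) → 3 ≤ count P → Distinct₃ P
distinct₃ P 3≤count with count-pick P 3≤count
... | x , Px , 2≤ with count-pick (P without x) 2≤
... | y , Py , 1≤ with count-witness (P without x without y) 1≤
... | z , Pz with without-elim P Py | without-elim (P without x) Pz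
... | Py′ , y≢x | Pz′ , z≢y with without-elim P Pz′
... | Pz″ , z≢x = record
  { x = x ; y = y ; z = z ; Px = Px ; Py = Py′ ; Pz = Pz″
  ; x≢y = ≢-sym y≢x ; x≢z = ≢-sym z≢x ; y≢z = ≢-sym z≢y }

Distinct₃⇒3≤count : ∀ {m} {P : Fin m → Bool} → Distinct₃ P → 3 ≤ count P
Distinct₃⇒3≤count {P = P} D = subst (3 ≤_) (sym count≡3+rest) (m≤m+n 3 _)
  where
    open Distinct₃ D
    open ≡-Reasoning
    Pz′ : (P without x without y) z ≡ true
    Pz′ = without-true (P without x) (without-true P Pz (≢-sym x≢z)) (≢-sym y≢z)
    count≡3+rest : count P ≡ 3 + count (P without x without y without z)
    count≡3+rest = begin
      count P                                     ≡⟨ count-without P Px ⟩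
      suc (count (P without x))                   ≡⟨ cong suc (count-without (P without x) (without-true P Py (≢-sym x≢y))) ⟩
      2 + count (P without x without y)           ≡⟨ cong (2 +_) (count-without (P without x without y) Pz′) ⟩
      3 + count (P without x without y without z) ∎

δ : ∀ {k} → Fin k → Fin k → ℕ
δ x y = χ (does (x ≟ y))

δ-refl : ∀ {k} (x : Fin k) → δ x x ≡ 1
δ-refl x = cong χ (dec-true (x ≟ x) refl)

δ-≢ : ∀ {k} {x y : Fin k} → x ≢ y → δ x y ≡ 0
δ-≢ {x = x} {y} x≢y = cong χ (dec-false (x ≟ y) x≢y)

δ-sym : ∀ {k} (x y : Fin k) → δ x y ≡ δ y x
δ-sym x y with x ≟ y
... | yes refl = sym (δ-refl x)
... | no x≢y   = sym (δ-≢ (≢-sym x≢y))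

δ≡1⇒≡ : ∀ {k} {x y : Fin k} → δ x y ≡ 1 → x ≡ y
δ≡1⇒≡ {x = x} {y} δ≡1 with x ≟ y
... | yes x≡y = x≡y

does-≟-true : ∀ {k} {x y : Fin k} → does (x ≟ y) ≡ true → x ≡ y
does-≟-true {x = x} {y} eq with x ≟ y
... | yes x≡y = x≡y

does-≟-false : ∀ {k} {x y : Fin k} → does (x ≟ y) ≡ false → x ≢ y
does-≟-false {x = x} {y} eq with x ≟ y
... | no x≢y = x≢y

+₃-cong : ∀ {a a′ b b′ c c′ : ℕ} → a ≡ a′ → b ≡ b′ → c ≡ c′ → a + b + c ≡ a′ + b′ + c′
+₃-cong a≡a′ b≡b′ c≡c′ = cong₂ _+_ (cong₂ _+_ a≡a′ b≡b′) c≡c′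

cross-cancel : ∀ {x y a b c d : ℕ} → x + b ≡ y + a → x + c ≡ y + d → a + c ≡ b + d
cross-cancel {x} {y} {a} {b} {c} {d} xb≡ya xc≡yd = +-cancelˡ-≡ (x + y) (a + c) (b + d) (begin
    (x + y) + (a + c)  ≡⟨ rearrange x y a c ⟩
    (y + a) + (x + c)  ≡⟨ cong₂ _+_ (sym xb≡ya) xc≡yd ⟩
    (x + b) + (y + d)  ≡⟨ interchange x b y d ⟩
    (x + y) + (b + d)  ∎)
  where
    open ≡-Reasoning
    rearrange : ∀ x y a c → (x + y) + (a + c) ≡ (y + a) + (x + c)
    rearrange = solve-∀

sumFin-cong : ∀ {m} {g h : Fin m → ℕ} → (∀ j → g j ≡ h j) → sumFin g ≡ sumFin h
sumFin-cong {zero}  g≗h = refl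
sumFin-cong {suc m} g≗h = cong₂ _+_ (g≗h zero) (sumFin-cong (g≗h ∘ suc))

sumFin-+ : ∀ {m} (g h : Fin m → ℕ) → sumFin (λ j → g j + h j) ≡ sumFin g + sumFin h
sumFin-+ {zero}  g h = refl
sumFin-+ {suc m} g h = trans (cong (g zero + h zero +_) (sumFin-+ (g ∘ suc) (h ∘ suc)))
                             (interchange (g zero) (h zero) (sumFin (g ∘ suc)) (sumFin (h ∘ suc)))

sumFin-δ : ∀ {m} (s : Fin m) → sumFin (λ j → δ j s) ≡ 1
sumFin-δ {suc m} zero    = cong suc (sumFin-0 {m})
  where
    sumFin-0 : ∀ {m} → sumFin {m} (λ _ → 0) ≡ 0
    sumFin-0 {zero}  = refl
    sumFin-0 {suc m} = sumFin-0 {m}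
sumFin-δ {suc m} (suc s) = sumFin-δ s

module _ {n k : ℕ} where

  -- y = x − eₛ + eₜ, stated without subtraction.
  record Move (s t : Fin k) (x y : Demand n k) : Set where
    constructor move
    field
      s≢t      : s ≢ t
      balanced : ∀ j → x at j + δ j t ≡ y at j + δ j s

  adjacent⇒move : ∀ {s t x y} → Adjacent s t x y → Move s t x y
  adjacent⇒move {s} {t} {x} {y} (s≢t , ys+1≡xs , yt≡xt+1 , y≡x-elsewhere) = move s≢t balanced
    where
      balanced : ∀ j → x at j + δ j t ≡ y at j + δ j s
      balanced j with j ≟ s | j ≟ t
      ... | yes refl | yes refl = ⊥-elim (s≢t refl)
      ... | yes refl | no  _    = trans (+-identityʳ _) (trans (sym ys+1≡xs) (+-comm 1 _))
      ... | no  _    | yes refl = trans (+-comm _ 1) (trans (sym yt≡xt+1) (sym (+-identityʳ _)))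
      ... | no  j≢s  | no  j≢t  = cong (_+ 0) (sym (y≡x-elsewhere j j≢s j≢t))

  move⇒adjacent : ∀ {s t x y} → Move s t x y → Adjacent s t x y
  move⇒adjacent {s} {t} {x} {y} (move s≢t bal) = s≢t , at-s , at-t , elsewhere
    where
      at-s : suc (y at s) ≡ x at s
      at-s = +-cancelʳ-≡ 0 _ _ (begin
        suc (y at s) + 0   ≡⟨ cong suc (+-identityʳ _) ⟩
        suc (y at s)       ≡⟨ +-comm 1 _ ⟩
        y at s + 1         ≡⟨ cong (y at s +_) (sym (δ-refl s)) ⟩
        y at s + δ s s     ≡⟨ sym (bal s) ⟩
        x at s + δ s t     ≡⟨ cong (x at s +_) (δ-≢ s≢t) ⟩
        x at s + 0         ∎)
        where open ≡-Reasoning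
      at-t : y at t ≡ suc (x at t)
      at-t = +-cancelʳ-≡ 0 _ _ (begin
        y at t + 0         ≡⟨ cong (y at t +_) (sym (δ-≢ (≢-sym s≢t))) ⟩
        y at t + δ t s     ≡⟨ sym (bal t) ⟩
        x at t + δ t t     ≡⟨ cong (x at t +_) (δ-refl t) ⟩
        x at t + 1         ≡⟨ +-comm _ 1 ⟩
        suc (x at t)       ≡⟨ sym (+-identityʳ _) ⟩
        suc (x at t) + 0   ∎)
        where open ≡-Reasoning
      elsewhere : ∀ j → j ≢ s → j ≢ t → y at j ≡ x at j
      elsewhere j j≢s j≢t = +-cancelʳ-≡ 0 _ _ (sym (begin
        x at j + 0         ≡⟨ cong (x at j +_) (sym (δ-≢ j≢t)) ⟩
        x at j + δ j t     ≡⟨ bal j ⟩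
        y at j + δ j s     ≡⟨ cong (y at j +_) (δ-≢ j≢s) ⟩
        y at j + 0         ∎))
        where open ≡-Reasoning

  move⇒ℓ1≡2 : ∀ {s t x y} → Move s t x y → ℓ1 x y ≡ 2
  move⇒ℓ1≡2 {s} {t} {x} {y} (move s≢t bal) = begin
      ℓ1 x y                                       ≡⟨ sumFin-cong distance ⟩
      sumFin (λ j → δ j s + δ j t)                 ≡⟨ sumFin-+ (λ j → δ j s) (λ j → δ j t) ⟩
      sumFin (λ j → δ j s) + sumFin (λ j → δ j t) ≡⟨ cong₂ _+_ (sumFin-δ s) (sumFin-δ t) ⟩
      2                                            ∎
    where
      open ≡-Reasoning
      ∣δs-δt∣ : ∀ j → ∣ δ j s - δ j t ∣ ≡ δ j s + δ j t
      ∣δs-δt∣ j with j ≟ s | j ≟ t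
      ... | yes refl | yes refl = ⊥-elim (s≢t refl)
      ... | yes _    | no  _    = refl
      ... | no  _    | yes _    = refl
      ... | no  _    | no  _    = refl
      distance : ∀ j → ∣ x at j - y at j ∣ ≡ δ j s + δ j t
      distance j = begin
        ∣ x at j - y at j ∣                       ≡⟨ sym (∣m+n-m+o∣≡∣n-o∣ (δ j t) (x at j) (y at j)) ⟩
        ∣ δ j t + x at j - δ j t + y at j ∣       ≡⟨ cong₂ ∣_-_∣ (trans (+-comm (δ j t) (x at j)) (bal j)) (+-comm (δ j t) (y at j)) ⟩
        ∣ y at j + δ j s - y at j + δ j t ∣       ≡⟨ ∣m+n-m+o∣≡∣n-o∣ (y at j) (δ j s) (δ j t) ⟩
        ∣ δ j s - δ j t ∣                         ≡⟨ ∣δs-δt∣ j ⟩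
        δ j s + δ j t                             ∎

  demand-ext : ∀ {x y : Demand n k} → (∀ j → x at j ≡ y at j) → x ≡ y
  demand-ext {demand xs x-total} {demand ys y-total} x≗y
    with trans (sym (tabulate∘lookup xs)) (trans (tabulate-cong x≗y) (tabulate∘lookup ys))
  ... | refl = cong (demand xs) (≡-irrelevant x-total y-total)

  move-unique : ∀ {s t x y y′} → Move s t x y → Move s t x y′ → y ≡ y′
  move-unique {s} {y = y} {y′} (move _ bal) (move _ bal′) = demand-ext λ j →
    +-cancelʳ-≡ (δ j s) (y at j) (y′ at j) (trans (sym (bal j)) (bal′ j))

  move-unit : (x : Demand n k) {s t : Fin k} → s ≢ t → 1 ≤ x at s → Σ (Demand n k) (Move s t x)
  move-unit x {s} {t} s≢t 1≤xs = demand (tabulate y) y-total , move s≢t balanced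
    where
      y : Fin k → ℕ
      y j = x at j + δ j t ∸ δ j s
      δs≤ : ∀ j → δ j s ≤ x at j + δ j t
      δs≤ j with j ≟ s
      ... | yes refl = ≤-trans 1≤xs (m≤m+n _ _)
      ... | no  _    = z≤n
      y+δs : ∀ j → lookup (tabulate y) j + δ j s ≡ x at j + δ j t
      y+δs j = trans (cong (_+ δ j s) (lookup∘tabulate y j)) (m∸n+n≡m (δs≤ j))
      balanced : ∀ j → x at j + δ j t ≡ lookup (tabulate y) j + δ j s
      balanced j = sym (y+δs j)
      y-total : sumFin (lookup (tabulate y)) ≡ n
      y-total = +-cancelʳ-≡ 1 _ _ (begin
          sumFin (lookup (tabulate y)) + 1                     ≡⟨ cong (sumFin (lookup (tabulate y)) +_) (sym (sumFin-δ s)) ⟩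
          sumFin (lookup (tabulate y)) + sumFin (λ j → δ j s)  ≡⟨ sym (sumFin-+ (lookup (tabulate y)) (λ j → δ j s)) ⟩
          sumFin (λ j → lookup (tabulate y) j + δ j s)         ≡⟨ sumFin-cong y+δs ⟩
          sumFin (λ j → x at j + δ j t)                        ≡⟨ sumFin-+ (lookup (vec x)) (λ j → δ j t) ⟩
          sumFin (lookup (vec x)) + sumFin (λ j → δ j t)       ≡⟨ cong₂ _+_ (total x) (sumFin-δ t) ⟩
          n + 1                                                ∎)
        where open ≡-Reasoning

  isNonEmpty : Demand n k → Fin k → Bool
  isNonEmpty v j = does (1 ≤? v at j)

  record NonEmptyOutside (v : Demand n k) (t i x : Fin k) : Set where
    field
      nonempty : 1 ≤ v at x
      x≢t      : x ≢ t
      x≢i      : x ≢ i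

  nonEmptyOutside : ∀ {v t i x} → (isNonEmpty v without t without i) x ≡ true → NonEmptyOutside v t i x
  nonEmptyOutside {v} {t} {i} {x} eq with without-elim (isNonEmpty v without t) eq
  ... | outside-t , x≢i with without-elim (isNonEmpty v) outside-t
  ...   | nonempty , x≢t = record
    { nonempty = ≤ᵇ⇒≤ 1 (v at x) (subst T (sym nonempty) tt) ; x≢t = x≢t ; x≢i = x≢i }

  nonEmptyExcept-empty : ∀ {v t} → v at t ≡ 0 → nonEmptyExcept v t ≡ nonEmpty v
  nonEmptyExcept-empty {v} {t} vt≡0 = sym (trans (count-split (isNonEmpty v) t)
    (cong (λ b → χ b + nonEmptyExcept v t) (dec-false (1 ≤? v at t) λ 1≤vt → 1+n≰n (subst (1 ≤_) vt≡0 1≤vt))))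

  nonEmptyExcept-all : ∀ {v} → (∀ j → v at j ≢ 0) → ∀ t → suc (nonEmptyExcept v t) ≡ k
  nonEmptyExcept-all {v} none-empty t = begin
      suc (nonEmptyExcept v t) ≡⟨ sym (count-without (isNonEmpty v) (all-nonempty t)) ⟩
      nonEmpty v               ≡⟨ count-cong all-nonempty ⟩
      count {k} (λ _ → true)   ≡⟨ count-true ⟩
      k                        ∎
    where
      open ≡-Reasoning
      all-nonempty : ∀ j → isNonEmpty v j ≡ true
      all-nonempty j = dec-true (1 ≤? v at j) (n≢0⇒n>0 (none-empty j))

  move-source-nonempty : ∀ {s t x y} → Move s t x y → 1 ≤ x at s
  move-source-nonempty m = subst (1 ≤_) (proj₁ (proj₂ (move⇒adjacent m))) (s≤s z≤n)

  move-elsewhere : ∀ {s t x y j} → Move s t x y → j ≢ s → j ≢ t → y at j ≡ x at j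
  move-elsewhere {j = j} m = proj₂ (proj₂ (proj₂ (move⇒adjacent m))) j

  move-siblings : ∀ {a c d w x y} → Move a d w x → Move c d w y → c ≢ a → Move c a x y
  move-siblings (move _ w→x) (move _ w→y) c≢a = move c≢a λ j → trans (sym (w→x j)) (w→y j)

  move-reorder : ∀ {a b c d u w w′ z} → Move a b u w → Move c d w z → Move c b u w′ → a ≢ d → Move a d w′ z
  move-reorder {a} {b} {c} {d} {u} {w} {w′} {z} (move _ u→w) (move _ w→z) (move _ u→w′) a≢d =
    move a≢d λ j → +-cancelʳ-≡ (δ j c) _ _ (begin
      w′ at j + δ j d + δ j c  ≡⟨ xy∙z≈xz∙y (w′ at j) (δ j d) (δ j c) ⟩
      w′ at j + δ j c + δ j d  ≡⟨ cong (_+ δ j d) (sym (u→w′ j)) ⟩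
      u at j + δ j b + δ j d   ≡⟨ cong (_+ δ j d) (u→w j) ⟩
      w at j + δ j a + δ j d   ≡⟨ xy∙z≈xz∙y (w at j) (δ j a) (δ j d) ⟩
      w at j + δ j d + δ j a   ≡⟨ cong (_+ δ j a) (w→z j) ⟩
      z at j + δ j c + δ j a   ≡⟨ xy∙z≈xz∙y (z at j) (δ j c) (δ j a) ⟩
      z at j + δ j a + δ j c   ∎)
    where open ≡-Reasoning

  move-reorder′ : ∀ {a b c d u w w′ z} → Move a b u w → Move c d w z → Move a d u w′ → c ≢ b → Move c b w′ z
  move-reorder′ {a} {b} {c} {d} {u} {w} {w′} {z} (move _ u→w) (move _ w→z) (move _ u→w′) c≢b =
    move c≢b λ j → +-cancelʳ-≡ (δ j a) _ _ (begin
      w′ at j + δ j b + δ j a  ≡⟨ xy∙z≈xz∙y (w′ at j) (δ j b) (δ j a) ⟩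
      w′ at j + δ j a + δ j b  ≡⟨ cong (_+ δ j b) (sym (u→w′ j)) ⟩
      u at j + δ j d + δ j b   ≡⟨ xy∙z≈xz∙y (u at j) (δ j d) (δ j b) ⟩
      u at j + δ j b + δ j d   ≡⟨ cong (_+ δ j d) (u→w j) ⟩
      w at j + δ j a + δ j d   ≡⟨ xy∙z≈xz∙y (w at j) (δ j a) (δ j d) ⟩
      w at j + δ j d + δ j a   ≡⟨ cong (_+ δ j a) (w→z j) ⟩
      z at j + δ j c + δ j a   ∎)
    where open ≡-Reasoning

Config : ℕ → ℕ → Set
Config n k = Fin n → Fin k

module _ {n k : ℕ} where

  AtMostTwoMoved : Config n k → Config n k → Set
  AtMostTwoMoved h₁ h₂ = ∀ a₁ a₂ a₃ → a₁ ≢ a₂ → a₁ ≢ a₃ → a₂ ≢ a₃ →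
    h₁ a₁ ≢ h₂ a₁ → h₁ a₂ ≢ h₂ a₂ → h₁ a₃ ≢ h₂ a₃ → ⊥

  atMostTwoMoved-sym : ∀ {h₁ h₂} → AtMostTwoMoved h₁ h₂ → AtMostTwoMoved h₂ h₁
  atMostTwoMoved-sym ≤2 a₁ a₂ a₃ a₁≢a₂ a₁≢a₃ a₂≢a₃ m₁ m₂ m₃ =
    ≤2 a₁ a₂ a₃ a₁≢a₂ a₁≢a₃ a₂≢a₃ (≢-sym m₁) (≢-sym m₂) (≢-sym m₃)

  others-fixed : ∀ {h₁ h₂} → AtMostTwoMoved h₁ h₂ → ∀ {b c} → b ≢ c → h₁ b ≢ h₂ b → h₁ c ≢ h₂ c →
    ∀ a → a ≢ b → a ≢ c → h₂ a ≡ h₁ a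
  others-fixed {h₁} {h₂} ≤2 {b} {c} b≢c mb mc a a≢b a≢c with h₂ a ≟ h₁ a
  ... | yes fixed = fixed
  ... | no  moved = ⊥-elim (≤2 b c a b≢c (≢-sym a≢b) (≢-sym a≢c) mb mc (≢-sym moved))

  record Direct (h₁ h₂ : Config n k) (s t : Fin k) (c : Fin n) : Set where
    field
      from  : h₁ c ≡ s
      to    : h₂ c ≡ t
      fixed : ∀ a → a ≢ c → h₂ a ≡ h₁ a

  record Relay (h₁ h₂ : Config n k) (s i t : Fin k) (b c : Fin n) : Set where
    field
      b≢c    : b ≢ c
      i≢s    : i ≢ s
      i≢t    : i ≢ t
      b-from : h₁ b ≡ s
      b-to   : h₂ b ≡ i
      c-from : h₁ c ≡ i
      c-to   : h₂ c ≡ t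
      fixed  : ∀ a → a ≢ b → a ≢ c → h₂ a ≡ h₁ a

  data Transition (h₁ h₂ : Config n k) (s t : Fin k) : Set where
    direct : ∀ {c} → Direct h₁ h₂ s t c → Transition h₁ h₂ s t
    relay  : ∀ {i b c} → Relay h₁ h₂ s i t b c → Transition h₁ h₂ s t

  module _ {h₁ h₂ : Config n k} {s t : Fin k} where

    direct-mover : ∀ {c a} → Direct h₁ h₂ s t c → h₁ a ≢ h₂ a → a ≡ c
    direct-mover {c} {a} D moved with a ≟ c
    ... | yes a≡c = a≡c
    ... | no  a≢c = ⊥-elim (moved (sym (Direct.fixed D a a≢c)))

    relay-mover : ∀ {i b c a} → Relay h₁ h₂ s i t b c → h₁ a ≢ h₂ a → a ≡ b ⊎ a ≡ c
    relay-mover {b = b} {c} {a} R moved with a ≟ b | a ≟ c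
    ... | yes a≡b | _       = inj₁ a≡b
    ... | no  _   | yes a≡c = inj₂ a≡c
    ... | no  a≢b | no  a≢c = ⊥-elim (moved (sym (Relay.fixed R a a≢b a≢c)))

    transition⇒atMostTwoMoved : Transition h₁ h₂ s t → AtMostTwoMoved h₁ h₂
    transition⇒atMostTwoMoved (direct D) a₁ a₂ _ a₁≢a₂ _ _ m₁ m₂ _ =
      a₁≢a₂ (trans (direct-mover D m₁) (sym (direct-mover D m₂)))
    transition⇒atMostTwoMoved (relay R) a₁ a₂ a₃ a₁≢a₂ a₁≢a₃ a₂≢a₃ m₁ m₂ m₃
      with relay-mover R m₁ | relay-mover R m₂ | relay-mover R m₃
    ... | inj₁ refl | inj₁ refl | _         = a₁≢a₂ refl
    ... | inj₂ refl | inj₂ refl | _         = a₁≢a₂ refl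
    ... | inj₁ refl | _         | inj₁ refl = a₁≢a₃ refl
    ... | inj₂ refl | _         | inj₂ refl = a₁≢a₃ refl
    ... | _         | inj₁ refl | inj₁ refl = a₂≢a₃ refl
    ... | _         | inj₂ refl | inj₂ refl = a₂≢a₃ refl

    transition-moved : Transition h₁ h₂ s t → ∀ {a} → h₁ a ≢ h₂ a → h₁ a ≡ s ⊎ h₂ a ≡ t
    transition-moved (direct D) moved with direct-mover D moved
    ... | refl = inj₁ (Direct.from D)
    transition-moved (relay R) moved with relay-mover R moved
    ... | inj₁ refl = inj₁ (Relay.b-from R)
    ... | inj₂ refl = inj₂ (Relay.c-to R)

    stays-or-arrives : Transition h₁ h₂ s t → ∀ {a} → h₁ a ≢ s → h₂ a ≡ h₁ a ⊎ h₂ a ≡ t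
    stays-or-arrives tr {a} not-from-s with h₂ a ≟ h₁ a
    ... | yes stays = inj₁ stays
    ... | no  moved with transition-moved tr (≢-sym moved)
    ...   | inj₁ from-s = ⊥-elim (not-from-s from-s)
    ...   | inj₂ to-t   = inj₂ to-t

    arrival-unique : Transition h₁ h₂ s t → ∀ {a a′} → h₁ a ≢ h₂ a → h₂ a ≡ t → h₁ a′ ≢ h₂ a′ → h₂ a′ ≡ t → a ≡ a′
    arrival-unique (direct D) m _ m′ _ = trans (direct-mover D m) (sym (direct-mover D m′))
    arrival-unique (relay {c = c} R) m to-t m′ to-t′ = trans (relay-arrival m to-t) (sym (relay-arrival m′ to-t′))
      where
        relay-arrival : ∀ {a} → h₁ a ≢ h₂ a → h₂ a ≡ t → a ≡ c
        relay-arrival m to-t with relay-mover R m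
        ... | inj₁ refl = ⊥-elim (Relay.i≢t R (trans (sym (Relay.b-to R)) to-t))
        ... | inj₂ a≡c  = a≡c

    relay-via : Transition h₁ h₂ s t → ∀ {a} → h₁ a ≢ h₂ a → h₂ a ≢ t → ∃[ c ] Relay h₁ h₂ s (h₂ a) t a c
    relay-via (direct D) m not-to-t with direct-mover D m
    ... | refl = ⊥-elim (not-to-t (Direct.to D))
    relay-via (relay {c = c} R) m not-to-t with relay-mover R m
    ... | inj₂ refl = ⊥-elim (not-to-t (Relay.c-to R))
    ... | inj₁ refl rewrite Relay.b-to R = c , R

  relay-shares-last-leg : ∀ {h₀ h h′ q s i t b c} → Relay h₀ h q i t b c → Transition h₀ h′ s t →
    AtMostTwoMoved h h′ → s ≢ q → s ≢ i → s ≢ t → ∃[ b′ ] Relay h₀ h′ s i t b′ c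
  relay-shares-last-leg {h₀} {h} {h′} {b = b} {c} R (direct {c′} D) ≤2 s≢q s≢i s≢t =
    ⊥-elim (≤2 b c c′ b≢c b≢c′ c≢c′
      (≢-by b-to (trans (Direct.fixed D b b≢c′) b-from) i≢s)
      (≢-by c-to (trans (Direct.fixed D c c≢c′) c-from) (≢-sym i≢t))
      (≢-by (trans (fixed c′ (≢-sym b≢c′) (≢-sym c≢c′)) (Direct.from D)) (Direct.to D) s≢t))
    where
      open Relay R
      b≢c′ = preimages-≢ h₀ b-from (Direct.from D) (≢-sym s≢q)
      c≢c′ = preimages-≢ h₀ c-from (Direct.from D) (≢-sym s≢i)
  relay-shares-last-leg {h₀} {h} {h′} {s = s} {i} {t} {b} {c} R (relay {i′} {b′} {c′} R′) ≤2 s≢q s≢i s≢t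
    with c′ ≟ c
  ... | yes refl = b′ , subst (λ j → Relay h₀ h′ s j t b′ c′) (trans (sym (Relay.c-from R′)) c-from) R′
    where open Relay R
  ... | no  c′≢c = ⊥-elim (≤2 c c′ b′ (≢-sym c′≢c) c≢b′ (Relay.b≢c R′ ∘ sym)
      (≢-by c-to (trans (Relay.fixed R′ c c≢b′ (≢-sym c′≢c)) c-from) (≢-sym i≢t))
      c′-moved
      (≢-by (trans (fixed b′ b′≢b b′≢c) (Relay.b-from R′)) (Relay.b-to R′) (≢-sym (Relay.i≢s R′))))
    where
      open Relay R
      c≢b′ = preimages-≢ h₀ c-from (Relay.b-from R′) (≢-sym s≢i)
      b′≢b = preimages-≢ h₀ (Relay.b-from R′) b-from s≢q
      b′≢c = ≢-sym c≢b′
      c′-moved : h c′ ≢ h′ c′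
      c′-moved with c′ ≟ b
      ... | yes refl = ≢-by b-to (Relay.c-to R′) i≢t
      ... | no  c′≢b = ≢-by (trans (fixed c′ c′≢b c′≢c) (Relay.c-from R′)) (Relay.c-to R′) (Relay.i≢t R′)

  direct-after-relay-clash : ∀ {h₀ h h′ x i t b a c} → Relay h₀ h x i t b a → Direct h₀ h′ i t c → c ≢ a →
    AtMostTwoMoved h h′ → ⊥
  direct-after-relay-clash {h₀} {h} {h′} {b = b} {a} {c} R D c≢a ≤2 =
    ≤2 b a c b≢c b≢c′ (≢-sym c≢a)
      (≢-by b-to (trans (Direct.fixed D b b≢c′) b-from) i≢s)
      (≢-by c-to (trans (Direct.fixed D a (≢-sym c≢a)) c-from) (≢-sym i≢t))
      (≢-by (trans (fixed c (≢-sym b≢c′) c≢a) (Direct.from D)) (Direct.to D) i≢t)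
    where
      open Relay R
      b≢c′ = preimages-≢ h₀ b-from (Direct.from D) (≢-sym i≢s)

  relay-after-relay-clash : ∀ {h₀ h h′ x i j t b a b′ c′} → Relay h₀ h x i t b a → Relay h₀ h′ i j t b′ c′ →
    j ≢ x → AtMostTwoMoved h h′ → ⊥
  relay-after-relay-clash {h₀} {h} {h′} {b = b} {a} {b′} {c′} R R′ j≢x ≤2 =
    ≤2 a c′ b a≢c′ (≢-sym b≢c) (preimages-≢ h₀ (Relay.c-from R′) b-from j≢x) a-moved c′-moved b-moved
    where
      open Relay R
      a≢c′ = preimages-≢ h₀ c-from (Relay.c-from R′) (≢-sym (Relay.i≢s R′))
      a-moved : h a ≢ h′ a
      a-moved with a ≟ b′
      ... | yes refl = ≢-by c-to (Relay.b-to R′) (≢-sym (Relay.i≢t R′))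
      ... | no  a≢b′ = ≢-by c-to (trans (Relay.fixed R′ a a≢b′ a≢c′) c-from) (≢-sym i≢t)
      c′-moved : h c′ ≢ h′ c′
      c′-moved with c′ ≟ b
      ... | yes refl = ≢-by b-to (Relay.c-to R′) i≢t
      ... | no  c′≢b = ≢-by (trans (fixed c′ c′≢b (≢-sym a≢c′)) (Relay.c-from R′)) (Relay.c-to R′) (Relay.i≢t R′)
      b-moved : h b ≢ h′ b
      b-moved = ≢-by b-to (trans (Relay.fixed R′ b b≢b′ (preimages-≢ h₀ b-from (Relay.c-from R′) (≢-sym j≢x))) b-from) i≢s
        where b≢b′ = preimages-≢ h₀ b-from (Relay.b-from R′) (≢-sym i≢s)

  relay-after-direct : ∀ {h₀ h₁ h₂ x i t a b} → Direct h₀ h₁ i t a → Relay h₀ h₂ x i t b a → Direct h₁ h₂ x i b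
  relay-after-direct {h₀} {h₁} {h₂} {a = a} {b} D R = record
    { from = trans (Direct.fixed D b b≢c) b-from ; to = b-to ; fixed = fixed′ }
    where
      open Relay R
      fixed′ : ∀ a′ → a′ ≢ b → h₂ a′ ≡ h₁ a′
      fixed′ a′ a′≢b with a′ ≟ a
      ... | yes refl = trans c-to (sym (Direct.to D))
      ... | no  a′≢a = trans (fixed a′ a′≢b a′≢a) (sym (Direct.fixed D a′ a′≢a))

  record Reassign₂ (h₀ h : Config n k) (α : Fin n) (x : Fin k) (β : Fin n) (y : Fin k) : Set where
    field
      α-to  : h α ≡ x
      β-to  : h β ≡ y
      fixed : ∀ a → a ≢ α → a ≢ β → h a ≡ h₀ a

  reassign₂-swap : ∀ {h₀ h α x β y} → Reassign₂ h₀ h α x β y → Reassign₂ h₀ h β y α x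
  reassign₂-swap r = record { α-to = β-to ; β-to = α-to ; fixed = λ a a≢β a≢α → fixed a a≢α a≢β }
    where open Reassign₂ r

  record Reassign₃ (h₀ h : Config n k) (α : Fin n) (x : Fin k) (β : Fin n) (y : Fin k) (d : Fin n) (z : Fin k) : Set where
    field
      α-to  : h α ≡ x
      β-to  : h β ≡ y
      d-to  : h d ≡ z
      fixed : ∀ a → a ≢ α → a ≢ β → a ≢ d → h a ≡ h₀ a

  Split : (h₀ h : Config n k) (α β : Fin n) (T p : Fin k) → Set
  Split h₀ h α β T p = Reassign₂ h₀ h α p β T ⊎ Reassign₂ h₀ h α T β p

  data Shape (h₀ h : Config n k) (α β : Fin n) (T p : Fin k) : Set where
    split  : Split h₀ h α β T p → Shape h₀ h α β T p
    gather : ∀ {d} → h₀ d ≡ T → Reassign₃ h₀ h α T β T d p → Shape h₀ h α β T p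

  shape : ∀ {h₀ h₁ h₂ h q r T p α β} →
    Direct h₀ h₁ q T α → Direct h₀ h₂ r T β → Transition h₁ h r p → Transition h₂ h q p →
    q ≢ r → T ≢ q → T ≢ r → p ≢ q → p ≢ r → T ≢ p → Shape h₀ h α β T p
  shape {h₀} {h₁} {h₂} {h} {q} {r} {T} {p} {α} {β} Dα Dβ tr₁ tr₂ q≢r T≢q T≢r p≢q p≢r T≢p =
    cases (arrives-at-T-or-p {a = α} tr₁ h₁α≡T T≢r) (arrives-at-T-or-p {a = β} tr₂ h₂β≡T T≢q)
    where
      h₁α≡T = Direct.to Dα
      h₂β≡T = Direct.to Dβ
      α≢β : α ≢ β
      α≢β = preimages-≢ h₀ (Direct.from Dα) (Direct.from Dβ) q≢r
      h₁β≡r : h₁ β ≡ r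
      h₁β≡r = trans (Direct.fixed Dα β (≢-sym α≢β)) (Direct.from Dβ)
      h₂α≡q : h₂ α ≡ q
      h₂α≡q = trans (Direct.fixed Dβ α α≢β) (Direct.from Dα)
      arrives-at-T-or-p : ∀ {h′ s a} → Transition h′ h s p → h′ a ≡ T → T ≢ s → h a ≡ T ⊎ h a ≡ p
      arrives-at-T-or-p tr h′a≡T T≢s with stays-or-arrives tr (≢-by h′a≡T refl T≢s)
      ... | inj₁ stays = inj₁ (trans stays h′a≡T)
      ... | inj₂ to-p  = inj₂ to-p
      moved-from : ∀ {h′ a x} → h′ a ≡ x → x ≢ T → x ≢ p → h a ≡ T ⊎ h a ≡ p → h′ a ≢ h a
      moved-from h′a≡x x≢T _   (inj₁ ha≡T) = ≢-by h′a≡x ha≡T x≢T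
      moved-from h′a≡x _   x≢p (inj₂ ha≡p) = ≢-by h′a≡x ha≡p x≢p
      β-moved₁ : h β ≡ T ⊎ h β ≡ p → h₁ β ≢ h β
      β-moved₁ = moved-from {h₁} {β} h₁β≡r (≢-sym T≢r) (≢-sym p≢r)
      α-moved₂ : h α ≡ T ⊎ h α ≡ p → h₂ α ≢ h α
      α-moved₂ = moved-from {h₂} {α} h₂α≡q (≢-sym T≢q) (≢-sym p≢q)
      cases : h α ≡ T ⊎ h α ≡ p → h β ≡ T ⊎ h β ≡ p → Shape h₀ h α β T p
      cases (inj₂ hα≡p) hβ@(inj₂ hβ≡p) =
        ⊥-elim (α≢β (arrival-unique tr₁ (≢-by h₁α≡T hα≡p T≢p) hα≡p (β-moved₁ hβ) hβ≡p))
      cases (inj₂ hα≡p) hβ@(inj₁ hβ≡T) = split (inj₁ record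
        { α-to = hα≡p ; β-to = hβ≡T
        ; fixed = λ a a≢α a≢β → trans
            (others-fixed (transition⇒atMostTwoMoved tr₁) α≢β (≢-by h₁α≡T hα≡p T≢p)
              (β-moved₁ hβ) a a≢α a≢β)
            (Direct.fixed Dα a a≢α) })
      cases hα@(inj₁ hα≡T) (inj₂ hβ≡p) = split (inj₂ record
        { α-to = hα≡T ; β-to = hβ≡p
        ; fixed = λ a a≢α a≢β → trans
            (others-fixed (transition⇒atMostTwoMoved tr₂) α≢β
              (α-moved₂ hα) (≢-by h₂β≡T hβ≡p T≢p) a a≢α a≢β)
            (Direct.fixed Dβ a a≢β) })
      cases (inj₁ hα≡T) hβ@(inj₁ hβ≡T)
        with relay-via tr₁ (β-moved₁ hβ) (≢-by hβ≡T refl T≢p)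
      ... | c , R = gather h₀c≡T record
        { α-to = hα≡T ; β-to = hβ≡T ; d-to = Relay.c-to R
        ; fixed = λ a a≢α a≢β a≢c → trans (Relay.fixed R a a≢β a≢c) (Direct.fixed Dα a a≢α) }
        where
          c≢α : c ≢ α
          c≢α = preimages-≢ h (Relay.c-to R) hα≡T (≢-sym T≢p)
          h₀c≡T : h₀ c ≡ T
          h₀c≡T = trans (sym (Direct.fixed Dα c c≢α)) (trans (Relay.c-from R) hβ≡T)

  split-conflict : ∀ {h₀ h h′ α β γ x y x′ y′} → Reassign₂ h₀ h α x β y → Reassign₂ h₀ h′ α x′ γ y′ →
    α ≢ β → α ≢ γ → β ≢ γ → x ≢ x′ → y ≢ h₀ β → y′ ≢ h₀ γ → AtMostTwoMoved h h′ → ⊥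
  split-conflict {α = α} {β} {γ} r r′ α≢β α≢γ β≢γ x≢x′ y≢h₀β y′≢h₀γ ≤2 =
    ≤2 α β γ α≢β α≢γ β≢γ
      (≢-by (Reassign₂.α-to r) (Reassign₂.α-to r′) x≢x′)
      (≢-by (Reassign₂.β-to r) (Reassign₂.fixed r′ β (≢-sym α≢β) β≢γ) y≢h₀β)
      (≢-by (Reassign₂.fixed r γ (≢-sym α≢γ) (≢-sym β≢γ)) (Reassign₂.β-to r′) (≢-sym y′≢h₀γ))

  -- Some αᵢ is sent to p in one configuration and to T in another; those two then differ in three agents.
  tournament : ∀ {h₀ h₁₂ h₁₃ h₂₃ α₁ α₂ α₃ T p} → T ≢ p → α₁ ≢ α₂ → α₁ ≢ α₃ → α₂ ≢ α₃ →
    T ≢ h₀ α₁ × p ≢ h₀ α₁ → T ≢ h₀ α₂ × p ≢ h₀ α₂ → T ≢ h₀ α₃ × p ≢ h₀ α₃ →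
    Split h₀ h₁₂ α₁ α₂ T p → Split h₀ h₁₃ α₁ α₃ T p → Split h₀ h₂₃ α₂ α₃ T p →
    AtMostTwoMoved h₁₂ h₁₃ → AtMostTwoMoved h₁₂ h₂₃ → AtMostTwoMoved h₁₃ h₂₃ → ⊥
  tournament T≢p α₁≢α₂ α₁≢α₃ α₂≢α₃ away₁ away₂ away₃ (inj₁ s₁₂) (inj₂ s₁₃) _ ≤2₁₂₋₁₃ _ _ =
    split-conflict s₁₂ s₁₃ α₁≢α₂ α₁≢α₃ α₂≢α₃ (≢-sym T≢p) (proj₁ away₂) (proj₂ away₃) ≤2₁₂₋₁₃
  tournament T≢p α₁≢α₂ α₁≢α₃ α₂≢α₃ away₁ away₂ away₃ (inj₂ s₁₂) (inj₁ s₁₃) _ ≤2₁₂₋₁₃ _ _ =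
    split-conflict s₁₂ s₁₃ α₁≢α₂ α₁≢α₃ α₂≢α₃ T≢p (proj₂ away₂) (proj₁ away₃) ≤2₁₂₋₁₃
  tournament T≢p α₁≢α₂ α₁≢α₃ α₂≢α₃ away₁ away₂ away₃ (inj₁ s₁₂) (inj₁ s₁₃) (inj₁ s₂₃) _ ≤2₁₂₋₂₃ _ =
    split-conflict (reassign₂-swap s₁₂) s₂₃ (≢-sym α₁≢α₂) α₂≢α₃ α₁≢α₃ T≢p (proj₂ away₁) (proj₁ away₃) ≤2₁₂₋₂₃
  tournament T≢p α₁≢α₂ α₁≢α₃ α₂≢α₃ away₁ away₂ away₃ (inj₁ s₁₂) (inj₁ s₁₃) (inj₂ s₂₃) _ _ ≤2₁₃₋₂₃ =
    split-conflict (reassign₂-swap s₁₃) (reassign₂-swap s₂₃) (≢-sym α₁≢α₃) (≢-sym α₂≢α₃) α₁≢α₂ T≢p (proj₂ away₁) (proj₁ away₂) ≤2₁₃₋₂₃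
  tournament T≢p α₁≢α₂ α₁≢α₃ α₂≢α₃ away₁ away₂ away₃ (inj₂ s₁₂) (inj₂ s₁₃) (inj₁ s₂₃) _ _ ≤2₁₃₋₂₃ =
    split-conflict (reassign₂-swap s₁₃) (reassign₂-swap s₂₃) (≢-sym α₁≢α₃) (≢-sym α₂≢α₃) α₁≢α₂ (≢-sym T≢p) (proj₁ away₁) (proj₂ away₂) ≤2₁₃₋₂₃
  tournament T≢p α₁≢α₂ α₁≢α₃ α₂≢α₃ away₁ away₂ away₃ (inj₂ s₁₂) (inj₂ s₁₃) (inj₂ s₂₃) _ ≤2₁₂₋₂₃ _ =
    split-conflict (reassign₂-swap s₁₂) s₂₃ (≢-sym α₁≢α₂) α₂≢α₃ α₁≢α₃ (≢-sym T≢p) (proj₁ away₁) (proj₂ away₃) ≤2₁₂₋₂₃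

  gather⇒relay : ∀ {h₀ h h′ α β d x y T p} → h₀ α ≡ x → h₀ β ≡ y → h₀ d ≡ T →
    Reassign₃ h₀ h α T β T d p → Transition h₀ h′ x p → AtMostTwoMoved h′ h →
    x ≢ y → x ≢ T → y ≢ T → T ≢ p → ∃[ b ] ∃[ c ] Relay h₀ h′ x T p b c
  gather⇒relay {h₀} {h} {h′} {α} {β} {d} {x} {y} {T} {p} h₀α h₀β h₀d G (direct {c} D) ≤2 x≢y x≢T y≢T T≢p =
    ⊥-elim (≤2 β d α β≢d β≢α d≢α β-moved d-moved α-moved)
    where
      open Reassign₃ G
      β≢d = preimages-≢ h₀ h₀β h₀d y≢T
      β≢α = preimages-≢ h₀ h₀β h₀α (≢-sym x≢y)
      d≢α = preimages-≢ h₀ h₀d h₀α (≢-sym x≢T)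
      unmoved : ∀ {a z} → h₀ a ≡ z → z ≢ x → h′ a ≡ z
      unmoved {a} h₀a z≢x = trans (Direct.fixed D a (preimages-≢ h₀ h₀a (Direct.from D) z≢x)) h₀a
      β-moved = ≢-by (unmoved h₀β (≢-sym x≢y)) β-to y≢T
      d-moved = ≢-by (unmoved h₀d (≢-sym x≢T)) d-to T≢p
      α-moved : h′ α ≢ h α
      α-moved with α ≟ c
      ... | yes refl = ≢-by (Direct.to D) α-to (≢-sym T≢p)
      ... | no  α≢c  = ≢-by (trans (Direct.fixed D α α≢c) h₀α) α-to x≢T
  gather⇒relay {h₀} {h} {h′} {α} {β} {d} {x} {y} {T} {p} h₀α h₀β h₀d G (relay {j} {e} {c} R) ≤2 x≢y x≢T y≢T T≢p
    with j ≟ T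
  ... | yes refl = e , c , R
  ... | no  j≢T  = ⊥-elim (≤2 β d e β≢d β≢e d≢e β-moved d-moved e-moved)
    where
      open Reassign₃ G
      open Relay R using (b-from; b-to; c-from; c-to; i≢s)
      β≢d = preimages-≢ h₀ h₀β h₀d y≢T
      β≢e = preimages-≢ h₀ h₀β b-from (≢-sym x≢y)
      d≢e = preimages-≢ h₀ h₀d b-from (≢-sym x≢T)
      d≢c = preimages-≢ h₀ h₀d c-from (≢-sym j≢T)
      β-moved : h′ β ≢ h β
      β-moved with β ≟ c
      ... | yes refl = ≢-by c-to β-to (≢-sym T≢p)
      ... | no  β≢c  = ≢-by (trans (Relay.fixed R β β≢e β≢c) h₀β) β-to y≢T
      d-moved = ≢-by (trans (Relay.fixed R d d≢e d≢c) h₀d) d-to T≢p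
      e-moved : h′ e ≢ h e
      e-moved with e ≟ α
      ... | yes refl = ≢-by b-to α-to j≢T
      ... | no  e≢α  = ≢-by b-to (trans (fixed e e≢α (≢-sym β≢e) (≢-sym d≢e)) b-from) i≢s

module _ {n k : ℕ} (f : Allocation n k) (valid : Valid f) (cost≤2 : MaxCostAtMost f 2) where

  σ : Demand n k → Config n k
  σ u a = f a u

  switched : ∀ (u w : Demand n k) {a} → σ u a ≢ σ w a → not (does (f a u ≟ f a w)) ≡ true
  switched u w {a} moved = cong not (dec-false (f a u ≟ f a w) moved)

  move⇒atMostTwoMoved : ∀ {s t u w} → Move s t u w → AtMostTwoMoved (σ u) (σ w)
  move⇒atMostTwoMoved {u = u} {w} m a₁ a₂ a₃ a₁≢a₂ a₁≢a₃ a₂≢a₃ m₁ m₂ m₃ =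
    3≰2 (≤-trans (Distinct₃⇒3≤count three-switched) (cost≤2 u w (move⇒ℓ1≡2 m)))
    where
      3≰2 : ¬ 3 ≤ 2
      3≰2 (s≤s (s≤s ()))
      three-switched : Distinct₃ (λ a → not (does (f a u ≟ f a w)))
      three-switched = record
        { x = a₁ ; y = a₂ ; z = a₃
        ; Px = switched u w m₁ ; Py = switched u w m₂ ; Pz = switched u w m₃
        ; x≢y = a₁≢a₂ ; x≢z = a₁≢a₃ ; y≢z = a₂≢a₃ }

  -- Occupancies and demands both change by eₜ − eₛ.
  two-movers-balance : ∀ {s t u w b d} → Move s t u w → d ≢ b → (∀ a → a ≢ b → a ≢ d → σ w a ≡ σ u a) →
    ∀ j → δ (σ u b) j + δ (σ u d) j + δ j t ≡ δ (σ w b) j + δ (σ w d) j + δ j s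
  two-movers-balance {s} {t} {u} {w} {b} {d} (move _ u→w) d≢b fixed j =
    cross-cancel {u at j} {w at j} (begin
      u at j + (δ (σ w b) j + δ (σ w d) j)     ≡⟨ cong (_+ _) (sym (valid u j)) ⟩
      count (occupants u) + (δ (σ w b) j + δ (σ w d) j)
        ≡⟨ count-agree-except₂ (occupants u) (occupants w) d≢b (λ a a≢b a≢d → cong (λ x → does (x ≟ j)) (sym (fixed a a≢b a≢d))) ⟩
      count (occupants w) + (δ (σ u b) j + δ (σ u d) j) ≡⟨ cong (_+ _) (valid w j) ⟩
      w at j + (δ (σ u b) j + δ (σ u d) j)     ∎)
      (u→w j)
    where
      open ≡-Reasoning
      occupants : Demand n k → Fin n → Bool
      occupants x a = does (f a x ≟ j)

  single-mover-fixed : ∀ {s t u w b} → Move s t u w → σ u b ≡ s → σ w b ≡ t → ∀ a → a ≢ b → σ w a ≡ σ u a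
  single-mover-fixed {s} {t} {u} {w} {b} m ub wb a a≢b with σ w a ≟ σ u a
  ... | yes fixed = fixed
  ... | no  moved = ⊥-elim (no-net-flow (δ x s) (δ x t) (begin
      δ x s + 1 + δ x t             ≡⟨ +₃-cong (trans (δ-sym x s) (cong (λ y → δ y x) (sym ub))) (sym (δ-refl x)) refl ⟩
      δ (σ u b) x + δ x x + δ x t   ≡⟨ two-movers-balance m a≢b fixed′ x ⟩
      δ (σ w b) x + δ (σ w a) x + δ x s ≡⟨ +₃-cong (trans (cong (λ y → δ y x) wb) (δ-sym t x)) (δ-≢ moved) refl ⟩
      δ x t + 0 + δ x s             ∎))
    where
      open ≡-Reasoning
      x = σ u a
      fixed′ : ∀ a′ → a′ ≢ b → a′ ≢ a → σ w a′ ≡ σ u a′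
      fixed′ = others-fixed (move⇒atMostTwoMoved m) (≢-sym a≢b)
                 (≢-by ub wb (Move.s≢t m)) (≢-sym moved)
      no-net-flow : ∀ p q → p + 1 + q ≢ q + 0 + p
      no-net-flow p q eq = 1+n≢n (trans (one-more p q) eq)
        where
          one-more : ∀ p q → suc (q + 0 + p) ≡ p + 1 + q
          one-more = solve-∀

  two-movers-relay : ∀ {s t u w b c} → Move s t u w → b ≢ c →
    σ u b ≡ s → σ w b ≢ s → σ u c ≢ t → σ w c ≡ t → Relay (σ u) (σ w) s (σ w b) t b c
  two-movers-relay {s} {t} {u} {w} {b} {c} m b≢c ub wb≢s uc≢t wc = record
    { b≢c = b≢c ; i≢s = wb≢s ; i≢t = i≢t ; b-from = ub ; b-to = refl
    ; c-from = c-from ; c-to = wc ; fixed = fixed }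
    where
      open ≡-Reasoning
      i = σ w b
      fixed : ∀ a → a ≢ b → a ≢ c → σ w a ≡ σ u a
      fixed = others-fixed (move⇒atMostTwoMoved m) b≢c (≢-by ub refl (≢-sym wb≢s)) (≢-by refl wc uc≢t)
      balance : ∀ j → δ (σ u b) j + δ (σ u c) j + δ j t ≡ δ (σ w b) j + δ (σ w c) j + δ j s
      balance = two-movers-balance m (≢-sym b≢c) fixed
      c-from : σ u c ≡ i
      c-from = δ≡1⇒≡ (+-cancelʳ-≡ (δ i t) (δ (σ u c) i) 1 (begin
        δ (σ u c) i + δ i t                 ≡⟨ +₃-cong {a = 0} (sym (trans (cong (λ x → δ x i) ub) (δ-≢ (≢-sym wb≢s)))) refl refl ⟩
        δ (σ u b) i + δ (σ u c) i + δ i t   ≡⟨ balance i ⟩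
        δ i i + δ (σ w c) i + δ i s         ≡⟨ +₃-cong (δ-refl i) (trans (cong (λ x → δ x i) wc) (δ-sym t i)) (δ-≢ wb≢s) ⟩
        1 + δ i t + 0                       ≡⟨ +-identityʳ (1 + δ i t) ⟩
        1 + δ i t                           ∎))
      i≢t : i ≢ t
      i≢t i≡t = 1≢2 (begin
        0 + 0 + 1                           ≡⟨ sym (+₃-cong (trans (cong (λ x → δ x t) ub) (δ-≢ (Move.s≢t m))) (δ-≢ uc≢t) (δ-refl t)) ⟩
        δ (σ u b) t + δ (σ u c) t + δ t t   ≡⟨ balance t ⟩
        δ i t + δ (σ w c) t + δ t s         ≡⟨ +₃-cong (trans (cong (λ x → δ x t) i≡t) (δ-refl t)) (trans (cong (λ x → δ x t) wc) (δ-refl t)) (δ-≢ (≢-sym (Move.s≢t m))) ⟩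
        1 + 1 + 0                           ∎)
        where
          1≢2 : 1 ≢ 2
          1≢2 ()

  move⇒transition : ∀ {s t u w} → Move s t u w → Transition (σ u) (σ w) s t
  move⇒transition {s} {t} {u} {w} m
    with count<⇒difference (occupants u s) (occupants w s) fewer
       | count<⇒difference (occupants w t) (occupants u t) more
    where
      occupants : Demand n k → Fin k → Fin n → Bool
      occupants x j a = does (f a x ≟ j)
      fewer : count (occupants w s) < count (occupants u s)
      fewer rewrite valid u s | valid w s = ≤-reflexive (proj₁ (proj₂ (move⇒adjacent m)))
      more : count (occupants u t) < count (occupants w t)
      more rewrite valid u t | valid w t = ≤-reflexive (sym (proj₁ (proj₂ (proj₂ (move⇒adjacent m)))))
  ... | b , ub , wb | c , wc , uc with b ≟ c
  ...   | yes refl = direct record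
    { from = does-≟-true ub ; to = does-≟-true wc
    ; fixed = single-mover-fixed m (does-≟-true ub) (does-≟-true wc) }
  ...   | no  b≢c  = relay (two-movers-relay m b≢c (does-≟-true ub) (does-≟-false wb) (does-≟-false uc) (does-≟-true wc))

  relay⇒type2-conditions : ∀ {s t i u w b c} → Relay (σ u) (σ w) s i t b c →
    switchingCost f u w ≡ 2 × Intermediate f s t u w i × Mobile f c i t u w
  relay⇒type2-conditions {u = u} {w} {b} {c} R =
    count≡2 (λ a → not (does (f a u ≟ f a w))) (≢-sym b≢c)
      (switched u w (≢-by b-from b-to (≢-sym i≢s))) (switched u w (≢-by c-from c-to i≢t)) unswitched ,
    (b , c , b≢c , (b-from , b-to , ≢-sym i≢s) , (c-from , c-to , i≢t)) ,
    (c-from , c-to , i≢t)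
    where
      open Relay R
      unswitched : ∀ a → a ≢ b → a ≢ c → not (does (f a u ≟ f a w)) ≡ false
      unswitched a a≢b a≢c = cong not (dec-true (f a u ≟ f a w) (sym (fixed a a≢b a≢c)))

  relay⇒type2With : ∀ {q t i u w b c} → Move q t u w → Relay (σ u) (σ w) q i t b c → Type2With f u t i c
  relay⇒type2With {q} {u = u} m R s w′ s≢i adj with adjacent⇒move {x = u} {y = w′} adj | s ≟ q
  ... | m′ | yes refl with move-unique m m′
  ...   | refl = relay⇒type2-conditions R
  relay⇒type2With {q} {u = u} m R s w′ s≢i adj | m′ | no s≢q
    with relay-shares-last-leg R (move⇒transition m′) (move⇒atMostTwoMoved (move-siblings m m′ s≢q))
           s≢q s≢i (Move.s≢t m′)
  ... | _ , R′ = relay⇒type2-conditions R′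

  type2With⇒relay : ∀ {t i a u s w} → Type2With f u t i a → s ≢ i → Move s t u w → ∃[ b ] Relay (σ u) (σ w) s i t b a
  type2With⇒relay {a = a} {u} {s} {w} T2 s≢i m with T2 s w s≢i (move⇒adjacent m)
  ... | _ , (b , c , b≢c , (ub , wb , _) , (uc , wc , i≢t)) , (ua , wa , _) with a ≟ c
  ...   | yes refl = b , record
    { b≢c = b≢c ; i≢s = ≢-sym s≢i ; i≢t = i≢t ; b-from = ub ; b-to = wb ; c-from = uc ; c-to = wc
    ; fixed = others-fixed (move⇒atMostTwoMoved m) b≢c (≢-by ub wb s≢i) (≢-by uc wc i≢t) }
  ...   | no  a≢c  = ⊥-elim (move⇒atMostTwoMoved m b c a b≢c (preimages-≢ (σ u) ub ua s≢i) (≢-sym a≢c)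
                       (≢-by ub wb s≢i) (≢-by uc wc i≢t) (≢-by ua wa i≢t))

  type2With⇒intermediate-nonempty : ∀ {t i a u s} → Type2With f u t i a → s ≢ i → s ≢ t → 1 ≤ u at s → 1 ≤ u at i
  type2With⇒intermediate-nonempty {i = i} {a} {u} {s} T2 s≢i s≢t 1≤us with move-unit u s≢t 1≤us
  ... | w , m with T2 s w s≢i (move⇒adjacent m)
  ...   | _ , _ , (ua , _ , _) =
    subst (1 ≤_) (valid u i) (witness⇒1≤count (λ b → does (f b u ≟ i)) (dec-true (f a u ≟ i) ua))

  module Fan (u : Demand n k) {T p : Fin k} (T≢p : T ≢ p) where

    record Source (x : Fin k) : Set where
      field
        x≢p       : x ≢ p
        agent     : Fin n
        result    : Demand n k
        step      : Move x T u result
        is-direct : Direct (σ u) (σ result) x T agent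

    open Source

    record Merge {x y} (X : Source x) (Y : Source y) : Set where
      field
        result : Demand n k
        after₁ : Move y p (Source.result X) result
        after₂ : Move x p (Source.result Y) result

    module _ {x y} (X : Source x) (Y : Source y) (x≢y : x ≢ y) where

      private
        x≢T = Move.s≢t (step X)
        y≢T = Move.s≢t (step Y)

      merge : Merge X Y
      merge = record { result = proj₁ z ; after₁ = proj₂ z ; after₂ = move-reorder (step X) (proj₂ z) (step Y) (x≢p X) }
        where
          z = move-unit (result X) (x≢p Y)
                (subst (1 ≤_) (sym (move-elsewhere (step X) (≢-sym x≢y) y≢T)) (move-source-nonempty (step Y)))

      merge-shape : (M : Merge X Y) → Shape (σ u) (σ (Merge.result M)) (agent X) (agent Y) T p
      merge-shape M = shape (is-direct X) (is-direct Y) (move⇒transition (Merge.after₁ M)) (move⇒transition (Merge.after₂ M))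
        x≢y (≢-sym x≢T) (≢-sym y≢T) (≢-sym (x≢p X)) (≢-sym (x≢p Y)) T≢p

      gather⇒type2 : (M : Merge X Y) → ∀ {d} → σ u d ≡ T →
        Reassign₃ (σ u) (σ (Merge.result M)) (agent X) T (agent Y) T d p → ∃[ a ] Type2With f u p T a
      gather⇒type2 M u-d≡T G with move-unit u (x≢p X) (move-source-nonempty (step X))
      ... | w , u→w with gather⇒relay (Direct.from (is-direct X)) (Direct.from (is-direct Y)) u-d≡T G (move⇒transition u→w)
                            (move⇒atMostTwoMoved (move-reorder′ (step X) (Merge.after₁ M) u→w y≢T)) x≢y x≢T y≢T T≢p
      ...   | _ , c , R = c , relay⇒type2With u→w R

    fan : ∀ {q r r′} → Source q → Source r → Source r′ → q ≢ r → q ≢ r′ → r ≢ r′ → ∃[ a ] Type2With f u p T a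
    fan Q R R′ q≢r q≢r′ r≢r′ = from-merges (merge Q R q≢r) (merge Q R′ q≢r′) (merge R R′ r≢r′)
      where
        from : ∀ {x} (X : Source x) → σ u (agent X) ≡ x
        from X = Direct.from (is-direct X)
        away : ∀ {x} (X : Source x) → T ≢ σ u (agent X) × p ≢ σ u (agent X)
        away X = ≢-by refl (from X) (≢-sym (Move.s≢t (step X))) , ≢-by refl (from X) (≢-sym (x≢p X))
        from-merges : Merge Q R → Merge Q R′ → Merge R R′ → ∃[ a ] Type2With f u p T a
        from-merges M₁ M₂ M₃ with merge-shape Q R q≢r M₁ | merge-shape Q R′ q≢r′ M₂ | merge-shape R R′ r≢r′ M₃
        ... | gather u-d≡T G | _ | _ = gather⇒type2 Q R q≢r M₁ u-d≡T G
        ... | _ | gather u-d≡T G | _ = gather⇒type2 Q R′ q≢r′ M₂ u-d≡T G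
        ... | _ | _ | gather u-d≡T G = gather⇒type2 R R′ r≢r′ M₃ u-d≡T G
        ... | split s₁₂ | split s₁₃ | split s₂₃ = ⊥-elim (tournament T≢p
              (preimages-≢ (σ u) (from Q) (from R) q≢r)
              (preimages-≢ (σ u) (from Q) (from R′) q≢r′)
              (preimages-≢ (σ u) (from R) (from R′) r≢r′)
              (away Q) (away R) (away R′) s₁₂ s₁₃ s₂₃
              (move⇒atMostTwoMoved (move-siblings (Merge.after₁ M₁) (Merge.after₁ M₂) (≢-sym r≢r′)))
              (move⇒atMostTwoMoved (move-siblings (Merge.after₂ M₁) (Merge.after₁ M₃) (≢-sym q≢r′)))
              (move⇒atMostTwoMoved (move-siblings (Merge.after₂ M₂) (Merge.after₂ M₃) (≢-sym q≢r))))

  relay-from : ∀ {v t i a x} → Type2With f v t i a → NonEmptyOutside v t i x →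
    Σ[ w ∈ Demand n k ] Move x t v w × ∃[ b ] Relay (σ v) (σ w) x i t b a
  relay-from T2 X with move-unit _ (NonEmptyOutside.x≢t X) (NonEmptyOutside.nonempty X)
  ... | w , m = w , m , type2With⇒relay T2 (NonEmptyOutside.x≢i X) m

  intermediate-step-direct : ∀ {v v′ t i a q r} → Type2With f v t i a → Move i t v v′ →
    q ≢ r → NonEmptyOutside v t i q → NonEmptyOutside v t i r → Direct (σ v) (σ v′) i t a
  intermediate-step-direct {v} {v′} {t} {i} {a} {q} {r} T2 m q≢r Q R = from-transition (move⇒transition m)
    where
      clash-via : ∀ {x} → NonEmptyOutside v t i x →
        (∀ {w b} → Relay (σ v) (σ w) x i t b a → AtMostTwoMoved (σ w) (σ v′) → ⊥) → ⊥
      clash-via X clash with relay-from T2 X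
      ... | w , m′ , _ , R′ = clash R′ (atMostTwoMoved-sym (move⇒atMostTwoMoved (move-siblings m m′ (NonEmptyOutside.x≢i X))))
      from-transition : Transition (σ v) (σ v′) i t → Direct (σ v) (σ v′) i t a
      from-transition (direct {c} D) with c ≟ a
      ... | yes refl = D
      ... | no  c≢a  = ⊥-elim (clash-via Q λ R′ → direct-after-relay-clash R′ D c≢a)
      from-transition (relay {j} R″) with j ≟ q
      ... | no  j≢q  = ⊥-elim (clash-via Q λ R′ → relay-after-relay-clash R′ R″ j≢q)
      ... | yes refl = ⊥-elim (clash-via R λ R′ → relay-after-relay-clash R′ R″ q≢r)

  type2-persists : ∀ {v v′ t i a} → Type2With f v t i a → 4 ≤ nonEmptyExcept v t → Adjacent i t v v′ →
    ∃[ a′ ] Type2With f v′ t i a′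
  type2-persists {v} {v′} {t} {i} {a} T2 4≤others adj =
    Fan.fan v′ (Move.s≢t m) (source Q) (source R) (source R′) x≢y x≢z y≢z
    where
      m = adjacent⇒move {x = v} {y = v′} adj
      open Distinct₃ (distinct₃ (isNonEmpty v without t without i)
        (≤-pred (≤-trans 4≤others (count≤1+without (isNonEmpty v without t) i))))
      Q = nonEmptyOutside Px
      R = nonEmptyOutside Py
      R′ = nonEmptyOutside Pz
      direct-step = intermediate-step-direct T2 m x≢y Q R
      source : ∀ {x} → NonEmptyOutside v t i x → Fan.Source v′ (Move.s≢t m) x
      source X with relay-from T2 X
      ... | w , m′ , b , R″ = record
        { x≢p = NonEmptyOutside.x≢t X ; agent = b ; result = w
        ; step = move-siblings m m′ (NonEmptyOutside.x≢i X)
        ; is-direct = relay-after-direct direct-step R″ }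

  direct-source-or-type2 : ∀ {v t p x} (t≢p : t ≢ p) → NonEmptyOutside v t p x → Type2 f v t ⊎ Fan.Source v t≢p x
  direct-source-or-type2 {v} t≢p X with move-unit v (NonEmptyOutside.x≢t X) (NonEmptyOutside.nonempty X)
  ... | w , m with move⇒transition m
  ...   | direct {c} D = inj₂ record { x≢p = NonEmptyOutside.x≢i X ; agent = c ; result = w ; step = m ; is-direct = D }
  ...   | relay {i} {_} {c} R = inj₁ (i , c , relay⇒type2With m R)

  type2-here-or-through : ∀ {v t p q r r′} (t≢p : t ≢ p) → q ≢ r → q ≢ r′ → r ≢ r′ →
    NonEmptyOutside v t p q → NonEmptyOutside v t p r → NonEmptyOutside v t p r′ →
    Type2 f v t ⊎ (1 ≤ v at t × Type2 f v p)
  type2-here-or-through {v} {t} {p} {q} {r} {r′} t≢p q≢r q≢r′ r≢r′ Q R R′ =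
    from-sources (direct-source-or-type2 t≢p Q) (direct-source-or-type2 t≢p R) (direct-source-or-type2 t≢p R′)
    where
      through : ∃[ a ] Type2With f v p t a → 1 ≤ v at t × Type2 f v p
      through (a , T2) = type2With⇒intermediate-nonempty T2 (NonEmptyOutside.x≢t Q) (NonEmptyOutside.x≢i Q)
                           (NonEmptyOutside.nonempty Q) , t , a , T2
      from-sources : Type2 f v t ⊎ Fan.Source v t≢p q → Type2 f v t ⊎ Fan.Source v t≢p r →
        Type2 f v t ⊎ Fan.Source v t≢p r′ → Type2 f v t ⊎ (1 ≤ v at t × Type2 f v p)
      from-sources (inj₁ T2) _ _ = inj₁ T2
      from-sources _ (inj₁ T2) _ = inj₁ T2
      from-sources _ _ (inj₁ T2) = inj₁ T2
      from-sources (inj₂ X) (inj₂ Y) (inj₂ Z) = inj₂ (through (Fan.fan v t≢p X Y Z q≢r q≢r′ r≢r′))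

  type2-here-or-elsewhere : ∀ {v t} → 4 ≤ nonEmptyExcept v t → Type2 f v t ⊎ (1 ≤ v at t × ∃[ p ] Type2 f v p)
  type2-here-or-elsewhere {v} {t} 4≤others with count-pick (isNonEmpty v without t) 4≤others
  ... | p , p-counted , 3≤others = map₂ (λ (1≤vt , T2) → 1≤vt , p , T2)
    (type2-here-or-through (≢-sym (proj₂ (without-elim (isNonEmpty v) p-counted)))
       x≢y x≢z y≢z (nonEmptyOutside Px) (nonEmptyOutside Py) (nonEmptyOutside Pz))
    where open Distinct₃ (distinct₃ (isNonEmpty v without t without p) 3≤others)

  -- An empty task is taken if there is one: it cannot be the intermediate task of a type-2 task.
  type2-with-four-others : 5 ≤ k → ∀ v → 4 ≤ nonEmpty v → ∃[ t ] (Type2 f v t × 4 ≤ nonEmptyExcept v t)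
  type2-with-four-others 5≤k v 4≤nonEmpty with any? (λ j → v at j ≟ℕ 0)
  ... | yes (t , vt≡0) = here-or-absurd (type2-here-or-elsewhere 4≤others)
    where
      4≤others : 4 ≤ nonEmptyExcept v t
      4≤others = subst (4 ≤_) (sym (nonEmptyExcept-empty {v = v} {t = t} vt≡0)) 4≤nonEmpty
      here-or-absurd : Type2 f v t ⊎ (1 ≤ v at t × ∃[ p ] Type2 f v p) → ∃[ t ] (Type2 f v t × 4 ≤ nonEmptyExcept v t)
      here-or-absurd (inj₁ T2)         = t , T2 , 4≤others
      here-or-absurd (inj₂ (1≤vt , _)) = ⊥-elim (1+n≰n (subst (1 ≤_) vt≡0 1≤vt))
  ... | no none-empty with count-witness (isNonEmpty v) (≤-trans (s≤s z≤n) 4≤nonEmpty)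
  ...   | t , _ = here-or-there (type2-here-or-elsewhere (4≤others t))
    where
      4≤others : ∀ t → 4 ≤ nonEmptyExcept v t
      4≤others t = ≤-pred (subst (5 ≤_) (sym (nonEmptyExcept-all {v = v} (λ j vj≡0 → none-empty (j , vj≡0)) t)) 5≤k)
      here-or-there : Type2 f v t ⊎ (1 ≤ v at t × ∃[ p ] Type2 f v p) → ∃[ t ] (Type2 f v t × 4 ≤ nonEmptyExcept v t)
      here-or-there (inj₁ T2)           = t , T2 , 4≤others t
      here-or-there (inj₂ (_ , p , T2)) = p , T2 , 4≤others p

lemma15 : (n k : ℕ) → 4 ≤ n → 5 ≤ k → (f : Allocation n k) → Valid f → MaxCostAtMost f 2 →
    (v : Demand n k) → 4 ≤ nonEmpty v →
      (∃[ t ] (Type2 f v t × 4 ≤ nonEmptyExcept v t))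
      × (∀ (t i : Fin k) (a : Fin n) → Type2With f v t i a → 4 ≤ nonEmptyExcept v t →
           ∀ (v' : Demand n k) → Adjacent i t v v' → ∃[ a' ] Type2With f v' t i a')
lemma15 n k _ 5≤k f valid cost≤2 v 4≤nonEmpty =
  type2-with-four-others f valid cost≤2 5≤k v 4≤nonEmpty ,
  λ t i a T2 4≤others v′ adj → type2-persists f valid cost≤2 T2 4≤others adj
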